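{- Let $M$ be a monoid, $\equiv$ an equivalence relation on $\mathbf{P}(M)$, and $\mathbb{P}_\equiv$ a $\mathbb{P}$-symbol for $\equiv$. Then $\equiv$ is a clone congruence of $\mathbf{P}(M)$ if and only if for every $n,m\ge0$, every $\mathfrak{p}\in\mathbf{P}(M)(n)$ and every $\mathfrak{p}'_1,\dots,\mathfrak{p}'_n\in\mathbf{P}(M)(m)$, $$\mathfrak{p}[\mathfrak{p}'_1,\dots,\mathfrak{p}'_n]\equiv\mathbb{P}_\equiv(\mathfrak{p})[\mathbb{P}_\equiv(\mathfrak{p}'_1),\dots,\mathbb{P}_\equiv(\mathfrak{p}'_n)].$$
   Context: For a monoid $(M,\cdot,e)$: an $M$-pigmented letter is a pair $i^\alpha$ ($i\ge1$ an integer, $\alpha\in M$); $\mathbf{P}(M)(n)$ is the set of words of $M$-pigmented letters with values in $[n]$, and $\mathbf{P}(M)=\bigsqcup_n\mathbf{P}(M)(n)$. For $\alpha\in M$, $\alpha\odot i_1^{\alpha_1}\cdots i_\ell^{\alpha_\ell}:=i_1^{\alpha\cdot\alpha_1}\cdots i_\ell^{\alpha\cdot\alpha_\ell}$. The clone $\mathbf{P}(M)$ has superposition $i_1^{\alpha_1}\cdots i_\ell^{\alpha_\ell}[\mathfrak{p}_1,\dots,\mathfrak{p}_n]:=(\alpha_1\odot\mathfrak{p}_{i_1})\cdots(\alpha_\ell\odot\mathfrak{p}_{i_\ell})$ and projections $i^e$. A clone congruence of $\mathbf{P}(M)$ is an equivalence relation relating only elements of equal arity such that $x\equiv x'$ and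 $y_j\equiv y'_j$ for all $j$ imply $x[y_1,\dots,y_n]\equiv x'[y'_1,\dots,y'_n]$. Convention: equivalence relations on $\mathbf{P}(M)$ relate only elements of the same arity, and maps $\mathbf{P}(M)\to\mathbf{P}(M)$ preserve arity. A $\mathbb{P}$-symbol for $\equiv$ is a map $\mathbb{P}_\equiv:\mathbf{P}(M)\to\mathbf{P}(M)$ such that $\mathfrak{p}\equiv\mathbb{P}_\equiv(\mathfrak{p})$ for all $\mathfrak{p}$, and $\mathfrak{p}\equiv\mathfrak{p}'$ implies $\mathbb{P}_\equiv(\mathfrak{p})=\mathbb{P}_\equiv(\mathfrak{p}')$. -}

module Defs where

open import Level using (Level; _⊔_; suc)
open import Data.Nat using (ℕ)
open import Data.Fin using (Fin)
open import Data.Product using (_×_; _,_)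
open import Data.List using (List; []; _∷_; _++_; map)
open import Relation.Binary.Core using (Rel)
open import Relation.Binary.Structures using (IsEquivalence)
open import Relation.Binary.PropositionalEquality using (_≡_)

-- M-pigmented words with values in [n] = {1,...,n}, encoded by Fin n
-- (letter i^α is the pair (i , α)).
module Pigmented {c : Level} (M : Set c) (_·_ : M → M → M) (e : M) where

  Letter : ℕ → Set c
  Letter n = Fin n × M

  P : ℕ → Set c
  P n = List (Letter n)

  _⊙_ : ∀ {m} → M → P m → P m
  α ⊙ p = map (λ { (i , β) → (i , (α · β)) }) p

  _[_] : ∀ {n m} → P n → (Fin n → P m) → P m
  [] [ q ] = []
  ((i , α) ∷ p) [ q ] = (α ⊙ q i) ++ (p [ q ])

  proj : ∀ {n} → Fin n → P n
  proj i = (i , e) ∷ []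

  Relation : (ℓ : Level) → Set (c ⊔ suc ℓ)
  Relation ℓ = ∀ n → Rel (P n) ℓ

  IsEquivalenceP : ∀ {ℓ} → Relation ℓ → Set (c ⊔ ℓ)
  IsEquivalenceP R = ∀ n → IsEquivalence (R n)

  IsCloneCongruence : ∀ {ℓ} → Relation ℓ → Set (c ⊔ ℓ)
  IsCloneCongruence R =
    IsEquivalenceP R ×
    (∀ n m (x x' : P n) (y y' : Fin n → P m) →
       R n x x' → (∀ j → R m (y j) (y' j)) → R m (x [ y ]) (x' [ y' ]))

  IsPSymbol : ∀ {ℓ} → Relation ℓ → (∀ {n} → P n → P n) → Set (c ⊔ ℓ)
  IsPSymbol R Ps =
    (∀ n (p : P n) → R n p (Ps p)) ×
    (∀ n (p p' : P n) → R n p p' → Ps p ≡ Ps p')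

{-# OPTIONS --safe #-}
module Submission where

open import Defs
open import Level using (_⊔_)
open import Data.Fin using (Fin)
open import Data.Product using (_,_; proj₁; proj₂)
open import Data.List using (_∷_; []; _++_)
open import Algebra.Structures using (IsMonoid)
open import Relation.Binary.Structures using (IsEquivalence)
open import Relation.Binary.PropositionalEquality using (_≡_; refl; cong; cong₂; subst; sym)
open import Function.Bundles using (_⇔_; mk⇔)

-- Since Ps takes one value on each class, related arguments give literally equal
-- superpositions of their symbols, so x [ y ] ≈ Ps x [ Ps ∘ y ] = Ps x' [ Ps ∘ y' ] ≈ x' [ y' ].

module _ {c} {M : Set c} {_·_ : M → M → M} {e : M} where
  open Pigmented M _·_ e

  []-congʳ : ∀ {n m} (x : P n) {y y' : Fin n → P m} →
             (∀ j → y j ≡ y' j) → x [ y ] ≡ x [ y' ]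
  []-congʳ []            y≡y' = refl
  []-congʳ ((i , α) ∷ x) y≡y' = cong₂ (λ q r → (α ⊙ q) ++ r) (y≡y' i) ([]-congʳ x y≡y')

  module _ {ℓ} {R : Relation ℓ} (isEquiv : IsEquivalenceP R)
           {Ps : ∀ {n} → P n → P n} (isPSymbol : IsPSymbol R Ps) where

    private
      module R≈ m = IsEquivalence (isEquiv m)

      R-Ps : ∀ n (p : P n) → R n p (Ps p)
      R-Ps = proj₁ isPSymbol

      Ps-resp : ∀ n (p p' : P n) → R n p p' → Ps p ≡ Ps p'
      Ps-resp = proj₂ isPSymbol

    SymbolCompatible : Set (c ⊔ ℓ)
    SymbolCompatible =
      ∀ n m (p : P n) (p' : Fin n → P m) → R m (p [ p' ]) (Ps p [ (λ j → Ps (p' j)) ])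

    Ps-[]-resp : ∀ {n m} {x x' : P n} {y y' : Fin n → P m} →
                 R n x x' → (∀ j → R m (y j) (y' j)) →
                 Ps x [ (λ j → Ps (y j)) ] ≡ Ps x' [ (λ j → Ps (y' j)) ]
    Ps-[]-resp {n} {m} {x} {x'} {y} {y'} x≈x' y≈y' =
      subst (λ z → Ps x [ (λ j → Ps (y j)) ] ≡ z [ (λ j → Ps (y' j)) ]) (Ps-resp n x x' x≈x')
            ([]-congʳ (Ps x) (λ j → Ps-resp m (y j) (y' j) (y≈y' j)))

    cloneCongruence⇒symbolCompatible : IsCloneCongruence R → SymbolCompatible
    cloneCongruence⇒symbolCompatible (_ , []-resp) n m p p' =
      []-resp n m p (Ps p) p' (λ j → Ps (p' j)) (R-Ps n p) (λ j → R-Ps m (p' j))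

    symbolCompatible⇒cloneCongruence : SymbolCompatible → IsCloneCongruence R
    symbolCompatible⇒cloneCongruence compatible = isEquiv , []-resp
      where
      []-resp : ∀ n m (x x' : P n) (y y' : Fin n → P m) →
                R n x x' → (∀ j → R m (y j) (y' j)) → R m (x [ y ]) (x' [ y' ])
      []-resp n m x x' y y' x≈x' y≈y' =
        R≈.trans m (compatible n m x y)
          (subst (λ z → R m z (x' [ y' ])) (sym (Ps-[]-resp x≈x' y≈y'))
                 (R≈.sym m (compatible n m x' y')))

proposition4p1p2 : ∀ {c ℓ} (M : Set c) (_·_ : M → M → M) (e : M) →
    IsMonoid _≡_ _·_ e →
    let open Pigmented M _·_ e in
    (R : Relation ℓ) → IsEquivalenceP R →
    (Ps : ∀ {n} → P n → P n) → IsPSymbol R Ps →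
    IsCloneCongruence R ⇔
      (∀ n m (p : P n) (p' : Fin n → P m) →
         R m (p [ p' ]) (Ps p [ (λ j → Ps (p' j)) ]))
proposition4p1p2 M _·_ e _ R isEquiv Ps isPSymbol =
  mk⇔ (cloneCongruence⇒symbolCompatible isEquiv isPSymbol)
      (symbolCompatible⇒cloneCongruence isEquiv isPSymbol)
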